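{- Let $q=p^n$ with $p$ prime. Let $V[x]$ be the $\mathbb{F}_q$-vector space of polynomials $f\in\mathbb{F}_q[x]$ of degree at most $q-2$ with $f(0)=0$, and let $\phi:V[x]\to V[x]$ be the linear map $\phi(f)(x)=f(x+1)-f(1)$. Let $f(x)=x^i+a_{i-1}x^{i-1}+\cdots+a_1x\in V[x]$ with $i\ge 2$ satisfy $\phi(f)=f$. Then $i$ is a multiple of $p$.
   Context: Polynomials in $V[x]$ are formal polynomials; $f(x+1)$ denotes formal substitution. -}

module Defs where

open import Level using (Level; _⊔_)
open import Data.Nat using (ℕ; zero; suc; _∸_; _≤_; _<_)
open import Data.Nat.Combinatorics using (_C_)
open import Data.Fin using (Fin)
open import Data.Product using (Σ; ∃; _×_; _,_)
open import Relation.Nullary using (¬_)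
open import Algebra.Bundles using (CommutativeRing; Semiring)
import Algebra.Definitions.RawSemiring as RS

module _ {c ℓ : Level} (R : CommutativeRing c ℓ) where
  open CommutativeRing R hiding (zero)
  open RS (Semiring.rawSemiring semiring) using () renaming (_×_ to _·_)

  IsField : Set (c ⊔ ℓ)
  IsField = (¬ (0# ≈ 1#)) × (∀ x → ¬ (x ≈ 0#) → ∃ λ y → x * y ≈ 1#)

  HasCard : ℕ → Set (c ⊔ ℓ)
  HasCard q = Σ (Fin q → Carrier) λ e →
      (∀ i j → e i ≈ e j → i ≡ j) × (∀ x → ∃ λ i → e i ≈ x)
    where open import Relation.Binary.PropositionalEquality using (_≡_)

  -- Polynomials are represented by coefficient sequences ℕ → Carrier
  -- (coefficient of x^k at k).  Finite sum Σ_{j<N} g j :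
  sumTo : ℕ → (ℕ → Carrier) → Carrier
  sumTo zero    g = 0#
  sumTo (suc N) g = sumTo N g + g N

  InV : ℕ → (ℕ → Carrier) → Set ℓ
  InV q f = (f 0 ≈ 0#) × (∀ k → q ∸ 2 < k → f k ≈ 0#)

  -- For f of degree ≤ q-2 (coefficients vanish from index q-1 on):
  -- value f(1) = Σ_{j<q-1} a_j
  evalOne : ℕ → (ℕ → Carrier) → Carrier
  evalOne q f = sumTo (q ∸ 1) f

  -- coefficients of f(x+1) = Σ_j a_j (x+1)^j : coefficient of x^k is Σ_j C(j,k) a_j
  shiftOne : ℕ → (ℕ → Carrier) → (ℕ → Carrier)
  shiftOne q f k = sumTo (q ∸ 1) (λ j → (j C k) · f j)

  φ : ℕ → (ℕ → Carrier) → (ℕ → Carrier)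
  φ q f zero    = shiftOne q f zero - evalOne q f
  φ q f (suc k) = shiftOne q f (suc k)

-- Comparing the coefficients of x^(i-1) in φ(f) = f (as i - 1 ≥ 1, the constant f(1)
-- does not enter) gives a_(i-1) + i·a_i = a_(i-1), hence i·1 = 0 in F.  Translation by 1
-- permutes the q elements of F, and comparing the sums of all elements before and after
-- gives q·1 = 0.  By Bézout then gcd(i, q)·1 = 0 as well; if p ∤ i this gcd is 1, so 1 = 0.

{-# OPTIONS --safe #-}
module Submission where

open import Defs
open import Level using (Level)
open import Data.Nat using (ℕ; _^_; _≤_; _∸_; _<_)
open import Data.Nat.Primality using (Prime)
open import Data.Nat.Divisibility using (_∣_)
open import Algebra.Bundles using (CommutativeRing)

open import Algebra.Bundles using (Semiring)
import Algebra.Definitions.RawSemiring as RawSemiring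
import Algebra.Properties.CommutativeMonoid.Sum as CommutativeMonoidSum
import Algebra.Properties.Group as GroupProperties
import Algebra.Properties.Monoid.Mult as MonoidMult
import Algebra.Properties.Semiring.Mult as SemiringMult
open import Data.Fin using (Fin)
open import Data.Fin.Permutation using (Permutation′; permutation)
open import Data.Nat as ℕ using (zero; suc; s≤s; _≤′_; ≤′-refl; ≤′-step)
open import Data.Nat.Combinatorics using (_C_; nCn≡1; nC1≡n; nCk≡nC[n∸k]; k>n⇒nCk≡0)
open import Data.Nat.Coprimality using (Coprime; coprime⇒GCD≡1; coprime-divisor; 1-coprimeTo)
import Data.Nat.Coprimality as Coprimality
open import Data.Nat.Divisibility using (_∤_; _∣?_; ∣-trans)
open import Data.Nat.GCD using (GCD; module Bézout)
open import Data.Nat.Primality using (prime⇒irreducible)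
open import Data.Nat.Properties using (n≤1+n; ≤-refl; m<n⇒m<1+n; m+n∸n≡m; ≮⇒≥; ≤′⇒≤; ≤⇒≤′)
open import Data.Product using (_,_; proj₁; proj₂)
open import Data.Sum using (inj₁; inj₂)
open import Relation.Nullary using (yes; no; contradiction)
open import Function using (_∘_)
open import Relation.Binary.PropositionalEquality as ≡ using (_≡_)

coprime-* : ∀ {m n o} → Coprime m n → Coprime m o → Coprime m (n ℕ.* o)
coprime-* {n = n} m⊥n m⊥o {d} (d∣m , d∣n*o) = m⊥o (d∣m , coprime-divisor d⊥n d∣n*o)
  where
  d⊥n : Coprime d n
  d⊥n (e∣d , e∣n) = m⊥n (∣-trans e∣d d∣m , e∣n)

coprime-^ : ∀ {m n} → Coprime m n → ∀ k → Coprime m (n ^ k)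
coprime-^ {m} m⊥n zero    = Coprimality.sym (1-coprimeTo m)
coprime-^     m⊥n (suc k) = coprime-* m⊥n (coprime-^ m⊥n k)

prime∧∤⇒coprime : ∀ {p n} → Prime p → p ∤ n → Coprime p n
prime∧∤⇒coprime p-prime p∤n (d∣p , d∣n) with prime⇒irreducible p-prime d∣p
... | inj₁ d≡1      = d≡1
... | inj₂ ≡.refl   = contradiction d∣n p∤n

[1+n]Cn≡1+n : ∀ n → suc n C n ≡ suc n
[1+n]Cn≡1+n n = begin
  suc n C n             ≡⟨ nCk≡nC[n∸k] (n≤1+n n) ⟩
  suc n C (suc n ∸ n)   ≡⟨ ≡.cong (suc n C_) (m+n∸n≡m 1 n) ⟩
  suc n C 1             ≡⟨ nC1≡n (suc n) ⟩
  suc n                 ∎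
  where open ≡.≡-Reasoning

≤∸2⇒<∸1 : ∀ {m} n → suc m ≤ n ∸ 2 → suc m < n ∸ 1
≤∸2⇒<∸1 (suc (suc n)) m<n = s≤s m<n

module _ {c ℓ : Level} (S : Semiring c ℓ) where
  open Semiring S
  open RawSemiring rawSemiring using (_×_)
  open MonoidMult +-monoid using (×-homo-+)
  open SemiringMult S using (×1-homo-*)
  open import Relation.Binary.Reasoning.Setoid setoid

  ×-zeroʳ : ∀ n → n × 0# ≈ 0#
  ×-zeroʳ zero    = refl
  ×-zeroʳ (suc n) = trans (+-identityˡ _) (×-zeroʳ n)

  *-×1≈0 : ∀ a b → b × 1# ≈ 0# → (a ℕ.* b) × 1# ≈ 0#
  *-×1≈0 a b b×1≈0 = trans (×1-homo-* a b) (trans (*-congˡ b×1≈0) (zeroʳ _))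

  +-×1≈0⇒×1≈0 : ∀ d a {b} → d ℕ.+ a ≡ b → a × 1# ≈ 0# → b × 1# ≈ 0# → d × 1# ≈ 0#
  +-×1≈0⇒×1≈0 d a {b} d+a≡b a×1≈0 b×1≈0 = begin
    d × 1#            ≈⟨ +-identityʳ _ ⟨
    d × 1# + 0#       ≈⟨ +-congˡ a×1≈0 ⟨
    d × 1# + a × 1#   ≈⟨ ×-homo-+ 1# d a ⟨
    (d ℕ.+ a) × 1#    ≡⟨ ≡.cong (_× 1#) d+a≡b ⟩
    b × 1#            ≈⟨ b×1≈0 ⟩
    0#                ∎

  gcd-×1≈0 : ∀ {m n d} → GCD m n d → m × 1# ≈ 0# → n × 1# ≈ 0# → d × 1# ≈ 0#
  gcd-×1≈0 {m} {n} {d} gcd m×1≈0 n×1≈0 with Bézout.identity gcd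
  ... | Bézout.+- x y d+yn≡xm = +-×1≈0⇒×1≈0 d (y ℕ.* n) d+yn≡xm (*-×1≈0 y n n×1≈0) (*-×1≈0 x m m×1≈0)
  ... | Bézout.-+ x y d+xm≡yn = +-×1≈0⇒×1≈0 d (x ℕ.* m) d+xm≡yn (*-×1≈0 x m m×1≈0) (*-×1≈0 y n n×1≈0)

module _ {c ℓ : Level} (F : CommutativeRing c ℓ) where
  open CommutativeRing F
  open RawSemiring (Semiring.rawSemiring semiring) using (_×_)
  open MonoidMult +-monoid using (×-congˡ; ×-congʳ; ×-homo-1)
  open GroupProperties +-group using (identityʳ-unique; //-rightDividesˡ; //-rightDividesʳ)
  open import Relation.Binary.Reasoning.Setoid setoid

  sumTo-zero : ∀ N g → (∀ j → j < N → g j ≈ 0#) → sumTo F N g ≈ 0#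
  sumTo-zero zero    g g≈0 = refl
  sumTo-zero (suc N) g g≈0 = begin
    sumTo F N g + g N   ≈⟨ +-cong (sumTo-zero N g (λ j j<N → g≈0 j (m<n⇒m<1+n j<N))) (g≈0 N ≤-refl) ⟩
    0# + 0#             ≈⟨ +-identityʳ 0# ⟩
    0#                  ∎

  sumTo-truncate : ∀ {N M} g → (∀ j → N ≤ j → g j ≈ 0#) → N ≤′ M → sumTo F M g ≈ sumTo F N g
  sumTo-truncate g g≈0 ≤′-refl = refl
  sumTo-truncate {N} {suc M} g g≈0 (≤′-step N≤′M) = begin
    sumTo F M g + g M   ≈⟨ +-cong (sumTo-truncate g g≈0 N≤′M) (g≈0 M (≤′⇒≤ N≤′M)) ⟩
    sumTo F N g + 0#    ≈⟨ +-identityʳ _ ⟩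
    sumTo F N g         ∎

  shiftOne-subleading : ∀ q f m → suc m < q ∸ 1 → (∀ k → suc m < k → f k ≈ 0#) →
                        shiftOne F q f m ≈ f m + suc m × f (suc m)
  shiftOne-subleading q f m m+1<q-1 f-deg≤m+1 = begin
    sumTo F (q ∸ 1) g                       ≈⟨ sumTo-truncate g vanishes-above (≤⇒≤′ m+1<q-1) ⟩
    sumTo F m g + g m + g (suc m)           ≈⟨ +-congʳ (+-cong (sumTo-zero m g vanishes-below) (×-congˡ (nCn≡1 m))) ⟩
    0# + 1 × f m + g (suc m)                ≈⟨ +-cong (trans (+-identityˡ _) (×-homo-1 (f m))) (×-congˡ ([1+n]Cn≡1+n m)) ⟩
    f m + suc m × f (suc m)                 ∎
    where
    g : ℕ → Carrier
    g j = (j C m) × f j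
    vanishes-below : ∀ j → j < m → g j ≈ 0#
    vanishes-below j j<m = ×-congˡ (k>n⇒nCk≡0 j<m)
    vanishes-above : ∀ j → suc (suc m) ≤ j → g j ≈ 0#
    vanishes-above j m+1<j = trans (×-congʳ (j C m) (f-deg≤m+1 j m+1<j)) (×-zeroʳ semiring (j C m))

  hasCard⇒×≈0 : ∀ {q} → HasCard F q → ∀ a → q × a ≈ 0#
  hasCard⇒×≈0 {q} (e , e-injective , e-surjective) a =
    identityʳ-unique (sum e) (q × a) (begin
      sum e + q × a                ≈⟨ +-congˡ (sum-replicate q) ⟨
      sum e + sum {q} (λ _ → a)    ≈⟨ ∑-distrib-+ e (λ _ → a) ⟨
      sum (λ k → e k + a)          ≈⟨ sum-cong-≋ (λ k → e∘index (e k + a)) ⟨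
      sum (e ∘ shift a)            ≈⟨ sum-permute e translate ⟨
      sum e                        ∎)
    where
    open CommutativeMonoidSum +-commutativeMonoid using (sum; sum-permute; ∑-distrib-+; sum-replicate; sum-cong-≋)
    index : Carrier → Fin q
    index x = proj₁ (e-surjective x)
    e∘index : ∀ x → e (index x) ≈ x
    e∘index x = proj₂ (e-surjective x)
    shift : Carrier → Fin q → Fin q
    shift b k = index (e k + b)
    shift-shift : ∀ b c k → e k + b + c ≈ e k → shift c (shift b k) ≡ k
    shift-shift b c k e+b+c≈e = e-injective _ _ (trans (e∘index _) (trans (+-congʳ (e∘index _)) e+b+c≈e))
    translate : Permutation′ q
    translate = permutation (shift a) (shift (- a))
      (λ k → shift-shift (- a) a k (//-rightDividesˡ a (e k)))
      (λ k → shift-shift a (- a) k (//-rightDividesʳ a (e k)))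

lemma4 : {c ℓ : Level} (F : CommutativeRing c ℓ) → IsField F →
    (p n : ℕ) → Prime p → HasCard F (p ^ n) →
    (f : ℕ → CommutativeRing.Carrier F) → (i : ℕ) → 2 ≤ i →
    InV F (p ^ n) f →
    CommutativeRing._≈_ F (f i) (CommutativeRing.1# F) →
    (∀ k → i < k → CommutativeRing._≈_ F (f k) (CommutativeRing.0# F)) →
    (∀ k → CommutativeRing._≈_ F (φ F (p ^ n) f k) (f k)) →
    p ∣ i
lemma4 F (0≉1 , _) p n p-prime card f i@(suc m@(suc _)) (s≤s (s≤s _)) (_ , f-deg≤q-2) fi≈1 f-deg≤i φf≈f
  with p ∣? i
... | yes p∣i = p∣i
... | no  p∤i = contradiction (sym 1≈0) 0≉1
  where
  open CommutativeRing F
  open RawSemiring (Semiring.rawSemiring semiring) using (_×_)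
  open MonoidMult +-monoid using (×-congʳ)
  open GroupProperties +-group using (identityʳ-unique)
  open import Relation.Binary.Reasoning.Setoid setoid
  q = p ^ n
  i<q-1 : i < q ∸ 1
  i<q-1 = ≤∸2⇒<∸1 q (≮⇒≥ (λ q-2<i → 0≉1 (trans (sym (f-deg≤q-2 i q-2<i)) fi≈1)))
  i×1≈0 : i × 1# ≈ 0#
  i×1≈0 = identityʳ-unique (f m) (i × 1#) (begin
    f m + i × 1#         ≈⟨ +-congˡ (×-congʳ i fi≈1) ⟨
    f m + i × f i        ≈⟨ shiftOne-subleading F q f m i<q-1 f-deg≤i ⟨
    shiftOne F q f m     ≈⟨ φf≈f m ⟩
    f m                  ∎)
  i⊥q : Coprime i q
  i⊥q = coprime-^ (Coprimality.sym (prime∧∤⇒coprime p-prime p∤i)) n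
  1≈0 : 1# ≈ 0#
  1≈0 = begin
    1#                   ≈⟨ +-identityʳ 1# ⟨
    1 × 1#               ≈⟨ gcd-×1≈0 semiring (coprime⇒GCD≡1 i⊥q) i×1≈0 (hasCard⇒×≈0 F card 1#) ⟩
    0#                   ∎
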